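{- There is a minion homomorphism $\xi\colon\mathcal Q_{\text{conv}}\to\omega(\mathcal Q_{\text{conv}})$.
   Context: Minions: an (abstract) minion $\mathcal M$ assigns to each finite set $X$ a set $\mathcal M^{(X)}$ (empty iff $X=\emptyset$) and to each $\pi\colon X\to Y$ a map $f\mapsto f^\pi$, $\mathcal M^{(X)}\to\mathcal M^{(Y)}$, with $f^{1_X}=f$ and $(f^\sigma)^\pi=f^{\pi\circ\sigma}$. A minion homomorphism $\xi\colon\mathcal M\to\mathcal N$ is a family $\xi_X\colon\mathcal M^{(X)}\to\mathcal N^{(X)}$ with $\xi_Y(f^\pi)=\xi_X(f)^\pi$ for all $\pi\colon X\to Y$. $\mathcal Q_{\text{conv}}^{(X)}$ is the set of functions $\lambda\colon X\to\mathbb Q$ with $\lambda\ge0$ and $\sum_{x\in X}\lambda(x)=1$ (rational probability distributions), with $\lambda^\pi(y)=\sum_{x\in\pi^{ -1}(y)}\lambda(x)$. For a minion $\mathcal M$, $\omega(\mathcal M)$ is the minion with $\omega(\mathcal M)^{(X)}=\{(Y,f):Y\subseteq X,\ f\in\mathcal M^{(Y)}\}$ and $(Z,f)^\pi=(\pi(Z),f^{\pi|_Z})$ for $\pi\colon X\to Y$, where $\pi|_Z$ is regarded as a map $Z\to\pi(Z)$. -}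

module Defs where

open import Data.Nat using (ℕ; zero; suc)
open import Data.Fin using (Fin; zero; suc)
open import Data.Bool using (Bool; true; false; T; if_then_else_; _∧_; _∨_)
open import Data.Unit using (tt)
open import Data.Product using (Σ; _×_; _,_)
open import Data.Rational using (ℚ; 0ℚ; 1ℚ; _+_; _≤_)
open import Data.Rational.Properties
  using (+-0-commutativeMonoid; +-mono-≤; ≤-refl; +-identityˡ; +-identityʳ)
open import Relation.Binary.PropositionalEquality
open import Algebra.Properties.CommutativeMonoid.Sum +-0-commutativeMonoid
  using (sum; ∑-comm)

-- Finite sets X are represented by the standard sets Fin n.
-- A subset Y ⊆ Fin n is a characteristic function Fin n → Bool; the
-- finite set Y itself is the subtype Σ (Fin n) (λ x → T (Y x)), and a
-- function on Y is a dependent function (x : Fin n) → T (Y x) → A.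
-- sum : (Fin n → ℚ) → ℚ is the standard finite sum (stdlib).

Subset : ℕ → Set
Subset n = Fin n → Bool

_==_ : ∀ {n} → Fin n → Fin n → Bool
zero  == zero  = true
zero  == suc _ = false
suc _ == zero  = false
suc x == suc y = x == y

anyFin : ∀ {n} → (Fin n → Bool) → Bool
anyFin {zero}  f = false
anyFin {suc n} f = f zero ∨ anyFin (λ x → f (suc x))

ext : (b : Bool) → (T b → ℚ) → ℚ
ext true  f = f tt
ext false f = 0ℚ

sumOn : ∀ {n} (Y : Subset n) → ((x : Fin n) → T (Y x) → ℚ) → ℚ
sumOn Y μ = sum (λ x → ext (Y x) (μ x))

image : ∀ {m n} → (Fin m → Fin n) → Subset m → Subset n
image π Z y = anyFin (λ x → Z x ∧ (π x == y))

-- Minion structure (carriers with their equality and the minor action).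
-- Only the data needed to state the notion of minion homomorphism.

record MinionData : Set₁ where
  field
    Carrier : ℕ → Set
    _≈_     : ∀ {n} → Carrier n → Carrier n → Set
    act     : ∀ {m n} → (Fin m → Fin n) → Carrier m → Carrier n

record MinionHom (M N : MinionData) : Set where
  private
    module M = MinionData M
    module N = MinionData N
  field
    ξ      : ∀ {n} → M.Carrier n → N.Carrier n
    ξ-cong : ∀ {n} {f g : M.Carrier n} → f M.≈ g → ξ f N.≈ ξ g
    ξ-comm : ∀ {m n} (π : Fin m → Fin n) (f : M.Carrier m) →
             ξ (M.act π f) N.≈ N.act π (ξ f)

sum-nonneg : ∀ {n} (f : Fin n → ℚ) → (∀ x → 0ℚ ≤ f x) → 0ℚ ≤ sum f
sum-nonneg {zero}  f h = ≤-refl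
sum-nonneg {suc n} f h =
  subst (_≤ (f zero + sum (λ x → f (suc x)))) (+-identityˡ 0ℚ) (+-mono-≤ (h zero) (sum-nonneg (λ x → f (suc x)) (λ x → h (suc x))))

sum-zero : ∀ {n} (f : Fin n → ℚ) → (∀ x → f x ≡ 0ℚ) → sum f ≡ 0ℚ
sum-zero {zero}  f h = refl
sum-zero {suc n} f h = trans (cong₂ _+_ (h zero) (sum-zero (λ x → f (suc x)) (λ x → h (suc x)))) (+-identityˡ 0ℚ)

sum-cong : ∀ {n} {f g : Fin n → ℚ} → (∀ x → f x ≡ g x) → sum f ≡ sum g
sum-cong {zero}  h = refl
sum-cong {suc n} h = cong₂ _+_ (h zero) (sum-cong (λ x → h (suc x)))

if-nonneg : ∀ b {c} → 0ℚ ≤ c → 0ℚ ≤ (if b then c else 0ℚ)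
if-nonneg true  p = p
if-nonneg false p = ≤-refl

sum-delta : ∀ {n} (i : Fin n) (c : ℚ) → sum (λ y → if i == y then c else 0ℚ) ≡ c
sum-delta {suc n} zero c =
  trans (cong (c +_) (sum-zero {n} (λ y → if zero == suc y then c else 0ℚ) λ y → refl)) (+-identityʳ c)
sum-delta {suc n} (suc i) c = trans (+-identityˡ _) (sum-delta i c)

anyFin-false : ∀ {n} (f : Fin n → Bool) → anyFin f ≡ false → ∀ x → f x ≡ false
anyFin-false {suc n} f h zero with f zero
... | false = refl
anyFin-false {suc n} f h (suc x) with f zero
... | false = anyFin-false (λ x → f (suc x)) h x

push : ∀ {m n} → (Fin m → Fin n) → (Fin m → ℚ) → (Fin n → ℚ)
push π w y = sum (λ x → if π x == y then w x else 0ℚ)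

push-nonneg : ∀ {m n} (π : Fin m → Fin n) (w : Fin m → ℚ) →
              (∀ x → 0ℚ ≤ w x) → ∀ y → 0ℚ ≤ push π w y
push-nonneg π w h y = sum-nonneg _ (λ x → if-nonneg (π x == y) (h x))

push-sum : ∀ {m n} (π : Fin m → Fin n) (w : Fin m → ℚ) → sum (push π w) ≡ sum w
push-sum π w = trans (sym (∑-comm (λ x y → if π x == y then w x else 0ℚ)))
                     (sum-cong (λ x → sum-delta (π x) (w x)))

record Dist (n : ℕ) : Set where
  constructor dist
  field
    wt     : Fin n → ℚ
    nonneg : ∀ x → 0ℚ ≤ wt x
    total  : sum wt ≡ 1ℚ

_≈D_ : ∀ {n} → Dist n → Dist n → Set
a ≈D b = ∀ x → Dist.wt a x ≡ Dist.wt b x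

actD : ∀ {m n} → (Fin m → Fin n) → Dist m → Dist n
actD π (dist w p q) = dist (push π w) (push-nonneg π w p) (trans (push-sum π w) q)

Qconv : MinionData
Qconv = record { Carrier = Dist ; _≈_ = _≈D_ ; act = actD }

record SubDist (n : ℕ) : Set where
  constructor subdist
  field
    supp   : Subset n
    wt     : (x : Fin n) → T (supp x) → ℚ
    nonneg : ∀ x (p : T (supp x)) → 0ℚ ≤ wt x p
    total  : sumOn supp wt ≡ 1ℚ

_≈S_ : ∀ {n} → SubDist n → SubDist n → Set
a ≈S b = (∀ x → SubDist.supp a x ≡ SubDist.supp b x)
       × (∀ x p q → SubDist.wt a x p ≡ SubDist.wt b x q)

restrictPush : ∀ {m n} → (Fin m → Fin n) → (Z : Subset m) →
               ((x : Fin m) → T (Z x) → ℚ) → Fin n → ℚ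
restrictPush π Z μ = push π (λ x → ext (Z x) (μ x))

private
  ext-nonneg : ∀ b (f : T b → ℚ) → (∀ p → 0ℚ ≤ f p) → 0ℚ ≤ ext b f
  ext-nonneg true  f h = h tt
  ext-nonneg false f h = ≤-refl

  outside-zero : ∀ {m n} (π : Fin m → Fin n) (Z : Subset m) μ y →
                 image π Z y ≡ false → restrictPush π Z μ y ≡ 0ℚ
  outside-zero π Z μ y e = sum-zero _ λ x → lem (Z x) (π x == y) (μ x)
                                              (anyFin-false _ e x)
    where
    lem : ∀ b c (f : T b → ℚ) → (b ∧ c) ≡ false → (if c then ext b f else 0ℚ) ≡ 0ℚ
    lem true  true  f ()
    lem true  false f _ = refl
    lem false true  f _ = refl
    lem false false f _ = refl

  ext-image : ∀ {m n} (π : Fin m → Fin n) (Z : Subset m) μ y →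
              ext (image π Z y) (λ _ → restrictPush π Z μ y) ≡ restrictPush π Z μ y
  ext-image π Z μ y with image π Z y in e
  ... | true  = refl
  ... | false = sym (outside-zero π Z μ y e)

actS : ∀ {m n} → (Fin m → Fin n) → SubDist m → SubDist n
actS π (subdist Z μ p q) =
  subdist (image π Z)
          (λ y _ → restrictPush π Z μ y)
          (λ y _ → push-nonneg π _ (λ x → ext-nonneg (Z x) (μ x) (p x)) y)
          (trans (sum-cong (ext-image π Z μ))
                 (trans (push-sum π _) q))

ωQconv : MinionData
ωQconv = record { Carrier = SubDist ; _≈_ = _≈S_ ; act = actS }

module Submission where

-- ξ sends a distribution λ on X to the pair (supp λ, λ restricted to supp λ).
-- It commutes with minors because the support of the pushforward λ^π is the
-- image π(supp λ): the weights are nonnegative, so the sum of λ over the fibre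
-- π⁻¹(y) vanishes exactly when λ vanishes on the whole fibre.

open import Defs
open import Data.Nat using (suc)
open import Data.Fin using (Fin; zero; suc)
open import Data.Bool using (Bool; true; false; not; if_then_else_; _∧_)
open import Data.Bool.Properties using (∧-conicalˡ; ∧-conicalʳ)
open import Data.Product using (_,_; ∃)
open import Data.Rational using (ℚ; 0ℚ; _+_; _≤_; _≟_)
open import Data.Rational.Properties
  using (≤-trans; ≤-antisym; +-monoʳ-≤; +-monoˡ-≤; +-identityʳ; +-identityˡ)
open import Relation.Nullary using (does; yes; no)
open import Relation.Nullary.Decidable using (dec-true; dec-false)
open import Relation.Binary.PropositionalEquality
open import Algebra.Properties.CommutativeMonoid.Sum Data.Rational.Properties.+-0-commutativeMonoid
  using (sum)

p≤p+q : ∀ {p q} → 0ℚ ≤ q → p ≤ p + q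
p≤p+q {p} 0≤q = subst (_≤ p + _) (+-identityʳ p) (+-monoʳ-≤ p 0≤q)

p≤q+p : ∀ {p q} → 0ℚ ≤ q → p ≤ q + p
p≤q+p {p} {q} 0≤q = subst (_≤ q + p) (+-identityˡ p) (+-monoˡ-≤ p 0≤q)

term≤sum : ∀ {n} (f : Fin n → ℚ) → (∀ x → 0ℚ ≤ f x) → ∀ x → f x ≤ sum f
term≤sum f f≥0 zero    = p≤p+q (sum-nonneg (λ x → f (suc x)) (λ x → f≥0 (suc x)))
term≤sum f f≥0 (suc x) = ≤-trans (term≤sum (λ x → f (suc x)) (λ x → f≥0 (suc x)) x) (p≤q+p (f≥0 zero))

sum≡0⇒term≡0 : ∀ {n} (f : Fin n → ℚ) → (∀ x → 0ℚ ≤ f x) → sum f ≡ 0ℚ → ∀ x → f x ≡ 0ℚ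
sum≡0⇒term≡0 f f≥0 Σf≡0 x = ≤-antisym (subst (f x ≤_) Σf≡0 (term≤sum f f≥0 x)) (f≥0 x)

==⇒≡ : ∀ {n} {x y : Fin n} → (x == y) ≡ true → x ≡ y
==⇒≡ {x = zero}  {zero}  _  = refl
==⇒≡ {x = suc x} {suc y} eq = cong suc (==⇒≡ eq)

==-refl : ∀ {n} (x : Fin n) → (x == x) ≡ true
==-refl zero    = refl
==-refl (suc x) = ==-refl x

anyFin-witness : ∀ {n} (f : Fin n → Bool) → anyFin f ≡ true → ∃ λ x → f x ≡ true
anyFin-witness {suc n} f any≡true with f zero in f0
... | true  = zero , f0
... | false with anyFin-witness (λ x → f (suc x)) any≡true
...   | x , fx = suc x , fx

nonzero? : ℚ → Bool
nonzero? q = not (does (q ≟ 0ℚ))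

nonzero?-false⇒≡0 : ∀ {q} → nonzero? q ≡ false → q ≡ 0ℚ
nonzero?-false⇒≡0 {q} _ with q ≟ 0ℚ
nonzero?-false⇒≡0 {q} _  | yes q≡0 = q≡0
nonzero?-false⇒≡0 {q} () | no _

≡0⇒nonzero?-false : ∀ {q} → q ≡ 0ℚ → nonzero? q ≡ false
≡0⇒nonzero?-false {q} q≡0 = cong not (dec-true (q ≟ 0ℚ) q≡0)

nonzero?-true⇒≢0 : ∀ {q} → nonzero? q ≡ true → q ≢ 0ℚ
nonzero?-true⇒≢0 nz q≡0 with () ← trans (sym nz) (≡0⇒nonzero?-false q≡0)

≢0⇒nonzero?-true : ∀ {q} → q ≢ 0ℚ → nonzero? q ≡ true
≢0⇒nonzero?-true {q} q≢0 = cong not (dec-false (q ≟ 0ℚ) q≢0)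

ext-nonzero? : ∀ q → ext (nonzero? q) (λ _ → q) ≡ q
ext-nonzero? q with nonzero? q in nz
... | true  = refl
... | false = sym (nonzero?-false⇒≡0 nz)

support : ∀ {n} → (Fin n → ℚ) → Subset n
support w x = nonzero? (w x)

module _ {m n} (π : Fin m → Fin n) (w : Fin m → ℚ) (w≥0 : ∀ x → 0ℚ ≤ w x) (y : Fin n) where

  private
    fibreTerm : Fin m → ℚ
    fibreTerm x = if π x == y then w x else 0ℚ

  push≡0⇒fibre≡0 : push π w y ≡ 0ℚ → ∀ x → π x ≡ y → w x ≡ 0ℚ
  push≡0⇒fibre≡0 push≡0 x refl = begin
    w x         ≡⟨ cong (if_then w x else 0ℚ) (sym (==-refl (π x))) ⟩
    fibreTerm x ≡⟨ sum≡0⇒term≡0 fibreTerm (λ x → if-nonneg (π x == y) (w≥0 x)) push≡0 x ⟩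
    0ℚ          ∎
    where open ≡-Reasoning

  support-push : support (push π w) y ≡ image π (support w) y
  support-push with image π (support w) y in y∈?image
  ... | true with anyFin-witness _ y∈?image
  ...   | x , x∈fibre = ≢0⇒nonzero?-true λ push≡0 →
            nonzero?-true⇒≢0 (∧-conicalˡ _ _ x∈fibre)
              (push≡0⇒fibre≡0 push≡0 x (==⇒≡ (∧-conicalʳ _ _ x∈fibre)))
  support-push | false =
    ≡0⇒nonzero?-false (sum-zero fibreTerm λ x → fibreTerm≡0 x (anyFin-false _ y∈?image x))
    where
    fibreTerm≡0 : ∀ x → (support w x ∧ (π x == y)) ≡ false → fibreTerm x ≡ 0ℚ
    fibreTerm≡0 x _  with support w x in x∉supp | π x == y
    fibreTerm≡0 x _  | _     | false = refl
    fibreTerm≡0 x _  | false | true  = nonzero?-false⇒≡0 x∉supp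
    fibreTerm≡0 x () | true  | true

restrictPush-support : ∀ {m n} (π : Fin m → Fin n) (w : Fin m → ℚ) →
                       ∀ y → restrictPush π (support w) (λ x _ → w x) y ≡ push π w y
restrictPush-support π w y =
  sum-cong λ x → cong (if π x == y then_else 0ℚ) (ext-nonzero? (w x))

restrictToSupport : ∀ {n} → Dist n → SubDist n
restrictToSupport (dist w w≥0 Σw≡1) =
  subdist (support w) (λ x _ → w x) (λ x _ → w≥0 x)
          (trans (sum-cong λ x → ext-nonzero? (w x)) Σw≡1)

lemmaD4 : MinionHom Qconv ωQconv
lemmaD4 = record
  { ξ      = restrictToSupport
  ; ξ-cong = λ w≈w′ → (λ x → cong nonzero? (w≈w′ x)) , (λ x _ _ → w≈w′ x)
  ; ξ-comm = λ { π (dist w w≥0 _) →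
               (λ y → support-push π w w≥0 y) , (λ y _ _ → sym (restrictPush-support π w y)) }
  }
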